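{- Let $(\delta_k)_{k\geq0}$ be formal variables with $\delta_0=1$, and let $\alpha,\beta\in\mathrm{NC}_n$ with $\alpha\leq\beta$. Then \[ \zeta(\beta^c,\alpha^c)=\prod_{\substack{B\in\beta,\ 1\notin B,\\ \min(B)\overset{\alpha}{\nsim}\max(B)}}\delta_{\iota(\alpha|_{[B]})-1}. \]
   Context: $\mathrm{NC}_n$ is the set of noncrossing partitions of $\{1,\dots,n\}$ (no $i<j<k<l$ with $i,k$ in one block and $j,l$ in another), ordered by refinement; $i\overset{\pi}{\sim}j$ means $i,j$ are in the same block of $\pi$. For finite $B\subset\mathbb{N}$, $\mathrm{NC}_B$ is defined likewise. Arcs of $\pi$: pairs $(i,j)$, $i<j$, in the same block with no element of that block strictly between them. Yoshida's weight: $\operatorname{wt}(\pi)=\prod_{(i,j)\text{ arc of }\pi}\delta_{j-i-1}$ for $\pi\in\mathrm{NC}_n$, and for $\pi\in\mathrm{NC}_B$ it is the weight of its image under the order-preserving bijection $B\to\{1,\dots,\#B\}$. For $\pi\leq\rho$ and $B$ a union of blocks of $\pi$, $\pi|_B=\{C\in\pi:C\subset B\}\in\mathrm{NC}_B$. $\zeta(\pi,\rho)=\prod_{B\in\rho}\operatorname{wt}(\pi|_B)$ if $\pi\leq\rho$, and $0$ otherwise. Kreweras complement: place labels $1,1',2,2',\dots,n,n'$ in this order on a line and draw $\pi$ with arches above the unprimed labels; $\pi^c\in\mathrm{NC}_n$ is defined by $i\overset{\pi^c}{\sim}j$ iff $i'$ and $j'$ can be joined by a path above the line not crossing the arches of $\pi$.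 (It is an order-reversing bijection of $\mathrm{NC}_n$.) For finite $B\subset\mathbb{N}$, $[B]=\{\min B,\min B+1,\dots,\max B\}$; if $B$ is a block of $\beta\geq\alpha$ then $[B]$ is a union of blocks of $\alpha$ and $\alpha|_{[B]}$ is defined. For $\pi\in\mathrm{NC}_n$, $\iota(\pi)$ is the number of blocks of the smallest interval partition (partition into intervals of consecutive integers) that is $\geq\pi$; for $\pi\in\mathrm{NC}_B$, $\iota(\pi)$ is computed after transporting $\pi$ to $\mathrm{NC}_{\#B}$ via the order-preserving bijection. -}

module Defs where

open import Level using (Level)
open import Data.Bool using (Bool; true; false; _∧_; _∨_; not; if_then_else_)
open import Data.Nat using (ℕ; zero; suc; _+_; _∸_; _≤_; _<_; _≡ᵇ_; _<ᵇ_; _≤ᵇ_; _⊔_)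
open import Data.List using (List; []; _∷_; map; upTo; foldr; length; filterᵇ)
open import Relation.Binary.PropositionalEquality using (_≡_)
open import Algebra.Bundles using (CommutativeSemiring)

-- [a , b] = a, a+1, ..., b   (empty if b < a)
range : ℕ → ℕ → List ℕ
range a b = map (λ k → a + k) (upTo (suc b ∸ a))

[1‥_] : ℕ → List ℕ
[1‥ n ] = range 1 n

between : ℕ → ℕ → List ℕ
between a b = range (suc a) (b ∸ 1)

_⇔ᵇ_ : Bool → Bool → Bool
true  ⇔ᵇ b = b
false ⇔ᵇ b = not b

_⇒ᵇ_ : Bool → Bool → Bool
a ⇒ᵇ b = not a ∨ b

allᵇ : (ℕ → Bool) → List ℕ → Bool
allᵇ p = foldr (λ x r → p x ∧ r) true

countᵇ : (ℕ → Bool) → List ℕ → ℕ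
countᵇ p xs = length (filterᵇ p xs)

maxL : List ℕ → ℕ
maxL = foldr _⊔_ 0

-- Partitions of {1,...,n} are given by their "same block" relation
-- i ~ j  (only its values on {1,...,n} matter).

Part : Set
Part = ℕ → ℕ → Bool

record NC (n : ℕ) : Set where
  field
    rel   : Part
    refl  : ∀ i → 1 ≤ i → i ≤ n → rel i i ≡ true
    sym   : ∀ i j → 1 ≤ i → i ≤ n → 1 ≤ j → j ≤ n → rel i j ≡ true → rel j i ≡ true
    trans : ∀ i j k → 1 ≤ i → i ≤ n → 1 ≤ j → j ≤ n → 1 ≤ k → k ≤ n →
            rel i j ≡ true → rel j k ≡ true → rel i k ≡ true
    noncrossing : ∀ i j k l → 1 ≤ i → i < j → j < k → k < l → l ≤ n →
                  rel i k ≡ true → rel j l ≡ true → rel i j ≡ true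
open NC public

_≤NC_ : {n : ℕ} → NC n → NC n → Set
_≤NC_ {n} π ρ = ∀ i j → 1 ≤ i → i ≤ n → 1 ≤ j → j ≤ n →
                rel π i j ≡ true → rel ρ i j ≡ true

leqᵇ : ℕ → Part → Part → Bool
leqᵇ n π ρ = allᵇ (λ i → allᵇ (λ j → π i j ⇒ᵇ ρ i j) [1‥ n ]) [1‥ n ]

arcIn : (B : ℕ → Bool) → Part → ℕ → ℕ → Bool
arcIn B π a b = B a ∧ B b ∧ (a <ᵇ b) ∧ π a b
              ∧ allᵇ (λ c → not (B c ∧ π a c)) (between a b)

arc : Part → ℕ → ℕ → Bool
arc = arcIn (λ _ → true)

isMin : ℕ → Part → ℕ → Bool
isMin n π m = allᵇ (λ c → not (π c m)) (range 1 (m ∸ 1))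

blockMax : ℕ → Part → ℕ → ℕ
blockMax n π m = maxL (filterᵇ (π m) [1‥ n ])

-- Kreweras complement: i ~ j in π^c iff i' and j' lie in the same region
-- above the line cut out by the arches of π, i.e. iff every arch (a,b)
-- of π encloses both or neither of i', j' (i' sits between i and i+1,
-- so it is enclosed by (a,b) iff a ≤ i < b).

encl : ℕ → ℕ → ℕ → Bool
encl a b i = (a ≤ᵇ i) ∧ (i <ᵇ b)

kreweras : ℕ → Part → Part
kreweras n π i j =
  allᵇ (λ a → allᵇ (λ b → arc π a b ⇒ᵇ (encl a b i ⇔ᵇ encl a b j)) [1‥ n ]) [1‥ n ]

-- ι(π|_[m,M]): number of blocks of the smallest interval partition of
-- [m,M] that is ≥ π|_[m,M].  A point k ∈ [m,M) is a cut iff no block of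
-- π|_[m,M] has elements a ≤ k < b; the blocks of the smallest interval
-- partition start at m and at k+1 for each cut k.

isCut : Part → ℕ → ℕ → ℕ → Bool
isCut π m M k = allᵇ (λ a → allᵇ (λ b → not (π a b ∧ encl a b k)) (range m M)) (range m M)

iotaInt : Part → ℕ → ℕ → ℕ
iotaInt π m M = countᵇ (λ x → (x ≡ᵇ m) ∨ isCut π m M (x ∸ 1)) (range m M)

module Weights {c ℓ : Level} (R : CommutativeSemiring c ℓ)
               (δ : ℕ → CommutativeSemiring.Carrier R) where
  open CommutativeSemiring R

  prod : List ℕ → (ℕ → Carrier) → Carrier
  prod xs f = foldr (λ x r → f x * r) 1# xs

  prodIf : List ℕ → (ℕ → Bool) → (ℕ → Carrier) → Carrier
  prodIf xs p f = prod (filterᵇ p xs) f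

  -- wt(π|_B) for B ⊆ {1..n}: transporting along the order-preserving
  -- bijection B → {1..#B}, an arc (a,b) of π|_B becomes an arc (a',b')
  -- with b' - a' - 1 = #(B ∩ (a,b)).
  wtRestr : ℕ → Part → (ℕ → Bool) → Carrier
  wtRestr n π B =
    prod [1‥ n ] (λ a → prodIf [1‥ n ] (arcIn B π a)
      (λ b → δ (countᵇ B (between a b))))

  -- ζ(π,ρ) = ∏_{B ∈ ρ} wt(π|_B) if π ≤ ρ, and 0 otherwise.
  -- Blocks of ρ are enumerated by their minima m; the block is ρ m.
  zeta : ℕ → Part → Part → Carrier
  zeta n π ρ = if leqᵇ n π ρ
               then prodIf [1‥ n ] (isMin n ρ) (λ m → wtRestr n π (ρ m))
               else 0#

  rhs : ℕ → Part → Part → Carrier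
  rhs n α β =
    prodIf [1‥ n ]
      (λ m → isMin n β m ∧ not (β m 1) ∧ not (α m (blockMax n β m)))
      (λ m → δ (iotaInt α m (blockMax n β m) ∸ 1))

module Submission where

-- Since complementation reverses order (complement-antitone), β^c ≤ α^c and
-- ζ(β^c, α^c) is the product over the blocks of α^c of the weights of the
-- arcs of β^c inside them.  Each arc of β^c lies in a single block of α^c,
-- so exchanging the products (ownBlock) leaves one factor per arc (a,b) of
-- β^c: δ of the number of points of the α^c-block of a strictly between a
-- and b.  The arcs of β^c come from the hulls [m, M] of the blocks of β
-- (ComplementArcs): a starts an arc iff m = a+1 is a block minimum, and the
-- arc ends at M.  The points of (a, M) in the α^c-block of a are the cuts
-- of α|[m,M] (Cuts), so the factor is δ_{ι(α|[m,M]) − 1}, which is δ₀ = 1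
-- when m ~α M (iota-connected).  Reindexing a ↦ a+1 (shiftToHulls) turns
-- the product over arc starts into the product over blocks of β.

open import Defs hiding (refl; sym; trans)
open import Level using (Level)
open import Data.Bool using (Bool; true; false; _∧_; _∨_; not; if_then_else_; T)
open import Data.Bool.Properties using (∧-conicalˡ; ∧-conicalʳ; ∧-zeroʳ; not-injective; ¬-not)
open import Data.Nat using (ℕ; zero; suc; _+_; _∸_; _≤_; _<_; z≤n; s≤s; z<s; _≡ᵇ_; _<ᵇ_; _≤ᵇ_)
open import Data.Nat.Properties
  using (+-identityʳ; +-monoˡ-≤; +-suc; +-∸-assoc; ∸-+-assoc; <-cmp; <-irrefl; <-trans; <-≤-trans; ≤-<-trans;
         <ᵇ⇒<; <⇒<ᵇ; ≡ᵇ⇒≡; ≡⇒≡ᵇ; ≤ᵇ⇒≤; ≤⇒≤ᵇ; <⇒≢; <⇒≤; <⇒≱; ≰⇒>; ≰⇒≥; ≤-pred; ≤-refl; ≤-trans; _≤?_; _<?_;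
         m+[n∸m]≡n; m<m+n; m≤n+m; m≤n⇒m<n∨m≡n; m≤n⇒m∸n≡0; m≤n⇒m≤1+n; n≤1+n; m≤m⊔n; m≤n⊔m; ⊔-sel; ⊔-identityʳ)
open import Data.List using (List; []; _∷_; map; filterᵇ; applyUpTo)
open import Data.List.Properties using (map-applyUpTo)
open import Data.List.Membership.Propositional using (_∈_)
open import Data.List.Membership.Propositional.Properties using (∈-filter⁺; ∈-filter⁻)
open import Data.List.Relation.Unary.Any using (here; there)
open import Function using (_∘_)
open import Data.Product using (∃-syntax; _×_; _,_; proj₁; proj₂)
open import Data.Sum using (inj₁; inj₂)
open import Data.Empty using (⊥; ⊥-elim)
open import Data.Unit using (tt)
open import Relation.Binary using (tri<; tri≈; tri>)
open import Relation.Binary.PropositionalEquality using (_≡_; _≢_; refl; sym; trans; cong; cong₂; subst; module ≡-Reasoning)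
open import Relation.Nullary using (yes; no)
open import Relation.Nullary.Decidable using (T?)
open import Algebra.Bundles using (CommutativeSemiring)

true-ext : ∀ {x y : Bool} → (x ≡ true → y ≡ true) → (y ≡ true → x ≡ true) → x ≡ y
true-ext {true}  {true}  _ _ = refl
true-ext {true}  {false} f _ = sym (f refl)
true-ext {false} {true}  _ g = g refl
true-ext {false} {false} _ _ = refl

true≢false : true ≡ false → ⊥
true≢false ()

∧-intro : ∀ {x y} → x ≡ true → y ≡ true → x ∧ y ≡ true
∧-intro refl refl = refl

∧-redundant : ∀ {x y} → (y ≡ true → x ≡ true) → x ∧ y ≡ y
∧-redundant {x} {true}  h = cong (_∧ true) (h refl)
∧-redundant {true}  {false} _ = refl
∧-redundant {false} {false} _ = refl

T⇒true : ∀ {b} → T b → b ≡ true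
T⇒true {true} _ = refl

true⇒T : ∀ {b} → b ≡ true → T b
true⇒T refl = tt

<ᵇ-true : ∀ {m n} → m < n → (m <ᵇ n) ≡ true
<ᵇ-true m<n = T⇒true (<⇒<ᵇ m<n)

<ᵇ-true⁻ : ∀ {m n} → (m <ᵇ n) ≡ true → m < n
<ᵇ-true⁻ {m} {n} h = <ᵇ⇒< m n (true⇒T h)

⇒ᵇ-elim : ∀ {x y} → (x ⇒ᵇ y) ≡ true → x ≡ true → y ≡ true
⇒ᵇ-elim h refl = h

⇒ᵇ-intro : ∀ {x y} → (x ≡ true → y ≡ true) → (x ⇒ᵇ y) ≡ true
⇒ᵇ-intro {true}  f = f refl
⇒ᵇ-intro {false} _ = refl

⇔ᵇ-elim : ∀ {x y} → (x ⇔ᵇ y) ≡ true → x ≡ y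
⇔ᵇ-elim {true}  {true}  _ = refl
⇔ᵇ-elim {false} {false} _ = refl

⇔ᵇ-intro : ∀ {x y} → x ≡ y → (x ⇔ᵇ y) ≡ true
⇔ᵇ-intro {true}  refl = refl
⇔ᵇ-intro {false} refl = refl

encl-intro : ∀ {a b i} → a ≤ i → i < b → encl a b i ≡ true
encl-intro a≤i i<b = ∧-intro (T⇒true (≤⇒≤ᵇ a≤i)) (<ᵇ-true i<b)

encl-≤ : ∀ a b {i} → encl a b i ≡ true → a ≤ i
encl-≤ a b {i} h = ≤ᵇ⇒≤ a i (true⇒T (∧-conicalˡ (a ≤ᵇ i) _ h))

encl-< : ∀ a b {i} → encl a b i ≡ true → i < b
encl-< a b {i} h = <ᵇ-true⁻ (∧-conicalʳ (a ≤ᵇ i) _ h)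

seg : ℕ → ℕ → List ℕ
seg a zero    = []
seg a (suc k) = a ∷ seg (suc a) k

applyUpTo-seg : ∀ a k (f : ℕ → ℕ) → (∀ i → f i ≡ a + i) → applyUpTo f k ≡ seg a k
applyUpTo-seg a zero    f f≗ = refl
applyUpTo-seg a (suc k) f f≗ =
  cong₂ _∷_ (trans (f≗ 0) (+-identityʳ a))
            (applyUpTo-seg (suc a) k (f ∘ suc) (λ i → trans (f≗ (suc i)) (+-suc a i)))

range≡seg : ∀ a b → range a b ≡ seg a (suc b ∸ a)
range≡seg a b = trans (map-applyUpTo (λ i → i) (a +_) (suc b ∸ a))
                      (applyUpTo-seg a _ (a +_) (λ _ → refl))

∈-seg⁻ : ∀ {x} a k → x ∈ seg a k → a ≤ x × x < a + k
∈-seg⁻ a (suc k) (here refl) = ≤-refl , m<m+n a z<s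
∈-seg⁻ {x} a (suc k) (there x∈) with ∈-seg⁻ (suc a) k x∈
... | a<x , x< = <⇒≤ a<x , subst (x <_) (sym (+-suc a k)) x<

∈-seg⁺ : ∀ {x} a k → a ≤ x → x < a + k → x ∈ seg a k
∈-seg⁺ {x} a zero    a≤x x< = ⊥-elim (<⇒≱ x< (subst (_≤ x) (sym (+-identityʳ a)) a≤x))
∈-seg⁺ {x} a (suc k) a≤x x< with m≤n⇒m<n∨m≡n a≤x
... | inj₂ refl = here refl
... | inj₁ a<x  = there (∈-seg⁺ (suc a) k a<x (subst (x <_) (+-suc a k) x<))

range-bound : ∀ {a b x} → a ≤ x → x < a + (suc b ∸ a) → x ≤ b
range-bound {a} {b} {x} a≤x x< with a ≤? suc b
... | yes a≤b+1 = ≤-pred (subst (x <_) (m+[n∸m]≡n a≤b+1) x<)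
... | no  a≰b+1 = ⊥-elim (<⇒≱ x< (subst (_≤ x) (sym (trans (cong (a +_) (m≤n⇒m∸n≡0 (≰⇒≥ a≰b+1))) (+-identityʳ a))) a≤x))

∈-range⁻ : ∀ {x} a b → x ∈ range a b → a ≤ x × x ≤ b
∈-range⁻ a b x∈ with ∈-seg⁻ a _ (subst (_ ∈_) (range≡seg a b) x∈)
... | a≤x , x< = a≤x , range-bound a≤x x<

∈-range⁺ : ∀ {x} a b → a ≤ x → x ≤ b → x ∈ range a b
∈-range⁺ {x} a b a≤x x≤b = subst (x ∈_) (sym (range≡seg a b))
  (∈-seg⁺ a _ a≤x (subst (x <_) (sym (m+[n∸m]≡n (≤-trans a≤x (m≤n⇒m≤1+n x≤b)))) (s≤s x≤b)))

allᵇ-true⁻ : ∀ p xs → allᵇ p xs ≡ true → ∀ {x} → x ∈ xs → p x ≡ true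
allᵇ-true⁻ p (y ∷ ys) h (here refl) = ∧-conicalˡ (p y) _ h
allᵇ-true⁻ p (y ∷ ys) h (there x∈)  = allᵇ-true⁻ p ys (∧-conicalʳ (p y) _ h) x∈

allᵇ-true⁺ : ∀ p xs → (∀ {x} → x ∈ xs → p x ≡ true) → allᵇ p xs ≡ true
allᵇ-true⁺ p []       _ = refl
allᵇ-true⁺ p (y ∷ ys) h = ∧-intro (h (here refl)) (allᵇ-true⁺ p ys (λ x∈ → h (there x∈)))

allᵇ-false⁻ : ∀ p xs → allᵇ p xs ≡ false → ∃[ x ] (x ∈ xs × p x ≡ false)
allᵇ-false⁻ p (y ∷ ys) h with p y in eq
... | false = y , here refl , eq
... | true with allᵇ-false⁻ p ys h
...   | x , x∈ , px = x , there x∈ , px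

allᵇ-cong : ∀ p q xs → (∀ x → p x ≡ q x) → allᵇ p xs ≡ allᵇ q xs
allᵇ-cong p q []       _ = refl
allᵇ-cong p q (x ∷ xs) h = cong₂ _∧_ (h x) (allᵇ-cong p q xs h)

allRange⁻ : ∀ p a b → allᵇ p (range a b) ≡ true → ∀ x → a ≤ x → x ≤ b → p x ≡ true
allRange⁻ p a b h x a≤x x≤b = allᵇ-true⁻ p (range a b) h (∈-range⁺ a b a≤x x≤b)

allRange⁺ : ∀ p a b → (∀ x → a ≤ x → x ≤ b → p x ≡ true) → allᵇ p (range a b) ≡ true
allRange⁺ p a b h = allᵇ-true⁺ p (range a b) (λ {x} x∈ → let (a≤x , x≤b) = ∈-range⁻ a b x∈ in h x a≤x x≤b)

allRange-false : ∀ p a b → allᵇ p (range a b) ≡ false → ∃[ x ] (a ≤ x × x ≤ b × p x ≡ false)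
allRange-false p a b h with allᵇ-false⁻ p (range a b) h
... | x , x∈ , px = x , proj₁ (∈-range⁻ a b x∈) , proj₂ (∈-range⁻ a b x∈) , px

<⇒≤∸1 : ∀ {x b} → x < b → x ≤ b ∸ 1
<⇒≤∸1 {b = suc b} x<b = ≤-pred x<b

≤∸1⇒< : ∀ {a x b} → a < x → x ≤ b ∸ 1 → x < b
≤∸1⇒< {b = suc b} _   x≤b = s≤s x≤b
≤∸1⇒< {b = zero}  a<x z≤n = ⊥-elim (<⇒≱ a<x z≤n)

allBetween⁻ : ∀ p a b → allᵇ p (between a b) ≡ true → ∀ x → a < x → x < b → p x ≡ true
allBetween⁻ p a b h x a<x x<b = allRange⁻ p (suc a) (b ∸ 1) h x a<x (<⇒≤∸1 x<b)

allBetween⁺ : ∀ p a b → (∀ x → a < x → x < b → p x ≡ true) → allᵇ p (between a b) ≡ true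
allBetween⁺ p a b h = allRange⁺ p (suc a) (b ∸ 1) (λ x a<x x≤ → h x a<x (≤∸1⇒< {a} a<x x≤))

_∈[1‥_] : ℕ → ℕ → Set
x ∈[1‥ n ] = 1 ≤ x × x ≤ n

[1‥]≡seg : ∀ n → [1‥ n ] ≡ seg 1 n
[1‥]≡seg n = range≡seg 1 n

count-∷ : ∀ p x xs → countᵇ p (x ∷ xs) ≡ (if p x then suc (countᵇ p xs) else countᵇ p xs)
count-∷ p x xs with p x
... | true  = refl
... | false = refl

count-cong : ∀ p q xs → (∀ {x} → x ∈ xs → p x ≡ q x) → countᵇ p xs ≡ countᵇ q xs
count-cong p q []       _ = refl
count-cong p q (x ∷ xs) h = begin
  countᵇ p (x ∷ xs)
    ≡⟨ count-∷ p x xs ⟩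
  (if p x then suc (countᵇ p xs) else countᵇ p xs)
    ≡⟨ cong₂ (λ b c → if b then suc c else c) (h (here refl)) (count-cong p q xs (λ x∈ → h (there x∈))) ⟩
  (if q x then suc (countᵇ q xs) else countᵇ q xs)
    ≡⟨ sym (count-∷ q x xs) ⟩
  countᵇ q (x ∷ xs) ∎
  where open ≡-Reasoning

count-none : ∀ p xs → (∀ {x} → x ∈ xs → p x ≡ false) → countᵇ p xs ≡ 0
count-none p []       _ = refl
count-none p (x ∷ xs) h rewrite h (here refl) = count-none p xs (λ x∈ → h (there x∈))

count-map : ∀ p (f : ℕ → ℕ) xs → countᵇ p (map f xs) ≡ countᵇ (λ x → p (f x)) xs
count-map p f []       = refl
count-map p f (x ∷ xs) with p (f x)
... | true  = cong suc (count-map p f xs)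
... | false = count-map p f xs

seg-suc : ∀ a k → seg (suc a) k ≡ map suc (seg a k)
seg-suc a zero    = refl
seg-suc a (suc k) = cong (suc a ∷_) (seg-suc (suc a) k)

maxL-≤ : ∀ {x} xs → x ∈ xs → x ≤ maxL xs
maxL-≤ (y ∷ ys) (here refl) = m≤m⊔n y (maxL ys)
maxL-≤ (y ∷ ys) (there x∈)  = ≤-trans (maxL-≤ ys x∈) (m≤n⊔m y (maxL ys))

maxL-∈ : ∀ {x} xs → x ∈ xs → maxL xs ∈ xs
maxL-∈ (y ∷ ys) _ = go y ys
  where
  go : ∀ y ys → maxL (y ∷ ys) ∈ (y ∷ ys)
  go y []       = here (⊔-identityʳ y)
  go y (z ∷ zs) with ⊔-sel y (maxL (z ∷ zs))
  ... | inj₁ y⊔≡y = here y⊔≡y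
  ... | inj₂ y⊔≡m = there (subst (_∈ (z ∷ zs)) (sym y⊔≡m) (go z zs))

arc-intro : ∀ (ρ : Part) {c d} → c < d → ρ c d ≡ true →
            (∀ x → c < x → x < d → ρ c x ≡ false) → arc ρ c d ≡ true
arc-intro ρ {c} {d} c<d c~d gap =
  ∧-intro (<ᵇ-true c<d) (∧-intro c~d (allBetween⁺ _ c d (λ x c<x x<d → cong not (gap x c<x x<d))))

arc-< : ∀ (ρ : Part) {c d} → arc ρ c d ≡ true → c < d
arc-< ρ {c} {d} h = <ᵇ-true⁻ (∧-conicalˡ (c <ᵇ d) _ h)

arc-rel : ∀ (ρ : Part) {c d} → arc ρ c d ≡ true → ρ c d ≡ true
arc-rel ρ {c} {d} h = ∧-conicalˡ (ρ c d) _ (∧-conicalʳ (c <ᵇ d) _ h)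

arc-gap : ∀ (ρ : Part) {c d} → arc ρ c d ≡ true → ∀ x → c < x → x < d → ρ c x ≡ false
arc-gap ρ {c} {d} h x c<x x<d =
  not-injective (allBetween⁻ _ c d (∧-conicalʳ (ρ c d) _ (∧-conicalʳ (c <ᵇ d) _ h)) x c<x x<d)

arc-unique : ∀ (ρ : Part) {a b b′} → arc ρ a b ≡ true → arc ρ a b′ ≡ true → b ≡ b′
arc-unique ρ {a} {b} {b′} h h′ with <-cmp b b′
... | tri≈ _ b≡b′ _ = b≡b′
... | tri< b<b′ _ _ = ⊥-elim (true≢false (trans (sym (arc-rel ρ h)) (arc-gap ρ h′ b (arc-< ρ h) b<b′)))
... | tri> _ _ b′<b = ⊥-elim (true≢false (trans (sym (arc-rel ρ h′)) (arc-gap ρ h b′ (arc-< ρ h′) b′<b)))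

arcIn-block : ∀ (B : ℕ → Bool) (ρ : Part) {a b} → B a ≡ true → (∀ {x} → ρ a x ≡ true → B x ≡ true) →
              arcIn B ρ a b ≡ arc ρ a b
arcIn-block B ρ {a} {b} a∈B closed rewrite a∈B =
  trans (cong (λ gap → B b ∧ ((a <ᵇ b) ∧ (ρ a b ∧ gap)))
              (allᵇ-cong _ _ (between a b) (λ c → cong not (∧-redundant closed))))
        (∧-redundant (λ h → closed (arc-rel ρ {a} {b} h)))

isMin⁻ : ∀ n (ρ : Part) {m} → isMin n ρ m ≡ true → ∀ c → 1 ≤ c → c < m → ρ c m ≡ false
isMin⁻ n ρ {suc m} h c 1≤c c<m = not-injective (allRange⁻ _ 1 m h c 1≤c (≤-pred c<m))

isMin-false⁻ : ∀ n (ρ : Part) {m} → isMin n ρ m ≡ false → ∃[ c ] (1 ≤ c × c < m × ρ c m ≡ true)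
isMin-false⁻ n ρ {suc m} h with allRange-false _ 1 m h
... | c , 1≤c , c≤m , nc = c , 1≤c , s≤s c≤m , not-injective nc

-- The Kreweras complement of an arbitrary relation ρ: i ~ j iff no arc of
-- ρ separates i′ from j′.  It is an equivalence relation on all of ℕ.
module Complement (n : ℕ) (ρ : Part) where

  K : Part
  K = kreweras n ρ

  K⁻ : ∀ {i j} → K i j ≡ true → ∀ {a b} → a ∈[1‥ n ] → b ∈[1‥ n ] →
       arc ρ a b ≡ true → encl a b i ≡ encl a b j
  K⁻ h (1≤a , a≤n) (1≤b , b≤n) ab =
    ⇔ᵇ-elim (⇒ᵇ-elim (allRange⁻ _ 1 n (allRange⁻ _ 1 n h _ 1≤a a≤n) _ 1≤b b≤n) ab)

  K⁺ : ∀ {i j} → (∀ {a b} → a ∈[1‥ n ] → b ∈[1‥ n ] → arc ρ a b ≡ true → encl a b i ≡ encl a b j) →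
       K i j ≡ true
  K⁺ h = allRange⁺ _ 1 n (λ a 1≤a a≤n → allRange⁺ _ 1 n (λ b 1≤b b≤n →
           ⇒ᵇ-intro (λ ab → ⇔ᵇ-intro (h (1≤a , a≤n) (1≤b , b≤n) ab))))

  K-refl : ∀ i → K i i ≡ true
  K-refl i = K⁺ (λ _ _ _ → refl)

  K-sym : ∀ {i j} → K i j ≡ true → K j i ≡ true
  K-sym h = K⁺ (λ a∈ b∈ ab → sym (K⁻ h a∈ b∈ ab))

  K-trans : ∀ {i j k} → K i j ≡ true → K j k ≡ true → K i k ≡ true
  K-trans h h′ = K⁺ (λ a∈ b∈ ab → trans (K⁻ h a∈ b∈ ab) (K⁻ h′ a∈ b∈ ab))

  K-block : ∀ {i j} → K i j ≡ true → ∀ x → K i x ≡ K j x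
  K-block h x = true-ext (K-trans (K-sym h)) (K-trans h)

  blockMin : ∀ {a} → a ∈[1‥ n ] → ∃[ j ] (j ∈[1‥ n ] × isMin n K j ≡ true × K j a ≡ true)
  blockMin {a} a∈ = descend a a∈ ≤-refl
    where
    descend : ∀ f {a} → a ∈[1‥ n ] → a ≤ f → ∃[ j ] (j ∈[1‥ n ] × isMin n K j ≡ true × K j a ≡ true)
    descend zero    a∈ a≤0 = ⊥-elim (<-irrefl refl (≤-trans (proj₁ a∈) a≤0))
    descend (suc f) {a} a∈ a≤f with isMin n K a in min?
    ... | true = a , a∈ , min? , K-refl a
    ... | false with isMin-false⁻ n K min?
    ...   | c , 1≤c , c<a , c~a with descend f (1≤c , ≤-trans (<⇒≤ c<a) (proj₂ a∈)) (≤-pred (<-≤-trans c<a a≤f))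
    ...     | j , j∈ , j-min , j~c = j , j∈ , j-min , K-trans j~c c~a

  blockMin-unique : ∀ {j j′} → j ∈[1‥ n ] → j′ ∈[1‥ n ] → isMin n K j ≡ true → isMin n K j′ ≡ true →
                    K j j′ ≡ true → j ≡ j′
  blockMin-unique {j} {j′} j∈ j′∈ min min′ j~j′ with <-cmp j j′
  ... | tri≈ _ j≡j′ _ = j≡j′
  ... | tri< j<j′ _ _ = ⊥-elim (true≢false (trans (sym j~j′) (isMin⁻ n K min′ j (proj₁ j∈) j<j′)))
  ... | tri> _ _ j′<j = ⊥-elim (true≢false (trans (sym (K-sym j~j′)) (isMin⁻ n K min j′ (proj₁ j′∈) j′<j)))

record ArcOver (ρ : Part) (a b i : ℕ) : Set where
  field
    c d   : ℕ
    isArc : arc ρ c d ≡ true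
    a~c   : ρ a c ≡ true
    a≤c   : a ≤ c
    c≤i   : c ≤ i
    i<d   : i < d
    d≤b   : d ≤ b

module Blocks {n : ℕ} (π : NC n) where

  ~refl : ∀ {x} → x ∈[1‥ n ] → rel π x x ≡ true
  ~refl (1≤x , x≤n) = NC.refl π _ 1≤x x≤n

  ~sym : ∀ {x y} → x ∈[1‥ n ] → y ∈[1‥ n ] → rel π x y ≡ true → rel π y x ≡ true
  ~sym (1≤x , x≤n) (1≤y , y≤n) = NC.sym π _ _ 1≤x x≤n 1≤y y≤n

  ~trans : ∀ {x y z} → x ∈[1‥ n ] → y ∈[1‥ n ] → z ∈[1‥ n ] →
           rel π x y ≡ true → rel π y z ≡ true → rel π x z ≡ true
  ~trans x∈ y∈ z∈ = NC.trans π _ _ _ (proj₁ x∈) (proj₂ x∈) (proj₁ y∈) (proj₂ y∈) (proj₁ z∈) (proj₂ z∈)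

  -- If a ~ b and a ≤ i < b, then some arc of the block of a inside [a,b]
  -- passes over i′: walk along the block, keeping i′ between the two ends.
  arcOver : ∀ {a b i} → a ∈[1‥ n ] → b ∈[1‥ n ] → a ≤ i → i < b →
            rel π a b ≡ true → ArcOver (rel π) a b i
  arcOver {a} {b} a∈ b∈ = walk b a∈ b∈ (m≤n+m b a)
    where
    -- induction on an upper bound f for the length b − a
    walk : ∀ f {a b i} → a ∈[1‥ n ] → b ∈[1‥ n ] → b ≤ a + f → a ≤ i → i < b →
           rel π a b ≡ true → ArcOver (rel π) a b i
    walk zero {a} {b} _ _ b≤a a≤i i<b _ =
      ⊥-elim (<⇒≱ (≤-<-trans a≤i i<b) (subst (b ≤_) (+-identityʳ a) b≤a))
    walk (suc f) {a} {b} {i} a∈@(1≤a , _) b∈@(_ , b≤n) b≤a+f a≤i i<b a~b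
      with allᵇ (λ x → not (rel π a x)) (between a b) in gap
    ... | true = record
      { c = a ; d = b ; a~c = ~refl a∈ ; a≤c = ≤-refl ; c≤i = a≤i ; i<d = i<b ; d≤b = ≤-refl
      ; isArc = arc-intro (rel π) (≤-<-trans a≤i i<b) a~b
                  (λ x a<x x<b → not-injective (allBetween⁻ _ a b gap x a<x x<b)) }
    ... | false with allRange-false _ (suc a) (b ∸ 1) gap
    ...   | x , a<x , x≤b-1 , nx with x ≤? i
    ...     | yes x≤i = record
      { c = c ; d = d ; isArc = isArc ; a~c = ~trans a∈ x∈ c∈ a~x a~c
      ; a≤c = ≤-trans (<⇒≤ a<x) a≤c ; c≤i = c≤i ; i<d = i<d ; d≤b = d≤b }
      where
      x<b = ≤∸1⇒< {a} a<x x≤b-1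
      a~x = not-injective nx
      x∈ : x ∈[1‥ n ]
      x∈ = ≤-trans 1≤a (<⇒≤ a<x) , ≤-trans (<⇒≤ x<b) b≤n
      r = walk f x∈ b∈ (≤-trans (subst (b ≤_) (+-suc a f) b≤a+f) (+-monoˡ-≤ f a<x)) x≤i i<b
               (~trans x∈ a∈ b∈ (~sym a∈ x∈ a~x) a~b)
      open ArcOver r
      c∈ : c ∈[1‥ n ]
      c∈ = ≤-trans (proj₁ x∈) a≤c , ≤-trans c≤i (≤-trans (<⇒≤ i<b) b≤n)
    ...     | no x≰i = record
      { c = c ; d = d ; isArc = isArc ; a~c = a~c
      ; a≤c = a≤c ; c≤i = c≤i ; i<d = i<d ; d≤b = ≤-trans d≤b (<⇒≤ x<b) }
      where
      x<b = ≤∸1⇒< {a} a<x x≤b-1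
      r = walk f a∈ (≤-trans 1≤a (<⇒≤ a<x) , ≤-trans (<⇒≤ x<b) b≤n)
               (≤-pred (subst (x <_) (+-suc a f) (<-≤-trans x<b b≤a+f))) a≤i (≰⇒> x≰i) (not-injective nx)
      open ArcOver r

  arcOver-ends : ∀ {a b i} → a ∈[1‥ n ] → b ∈[1‥ n ] → (r : ArcOver (rel π) a b i) →
                 ArcOver.c r ∈[1‥ n ] × ArcOver.d r ∈[1‥ n ]
  arcOver-ends (1≤a , _) (_ , b≤n) r =
    (≤-trans 1≤a a≤c , ≤-trans c≤i (≤-trans (<⇒≤ i<d) (≤-trans d≤b b≤n))) ,
    (≤-trans 1≤a (≤-trans a≤c (≤-trans c≤i (<⇒≤ i<d))) , ≤-trans d≤b b≤n)
    where open ArcOver r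

  arcOver-transfer : ∀ {a b i j} → a ∈[1‥ n ] → b ∈[1‥ n ] → (r : ArcOver (rel π) a b i) →
                     kreweras n (rel π) i j ≡ true → encl (ArcOver.c r) (ArcOver.d r) j ≡ true
  arcOver-transfer a∈ b∈ r i~j =
    trans (sym (Complement.K⁻ n (rel π) i~j (proj₁ (arcOver-ends a∈ b∈ r)) (proj₂ (arcOver-ends a∈ b∈ r)) isArc))
          (encl-intro c≤i i<d)
    where open ArcOver r

unseparated : ∀ {n} (β : NC n) {i j a b} → kreweras n (rel β) i j ≡ true →
              a ∈[1‥ n ] → b ∈[1‥ n ] → rel β a b ≡ true → encl a b i ≡ true → encl a b j ≡ true
unseparated {n} β {i} {j} {a} {b} h a∈ b∈ a~b i-under =
  encl-intro (≤-trans a≤c (encl-≤ c d j-under)) (≤-trans (encl-< c d j-under) d≤b)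
  where
  open Blocks β
  r = arcOver a∈ b∈ (encl-≤ a b i-under) (encl-< a b i-under) a~b
  open ArcOver r
  j-under : encl c d j ≡ true
  j-under = arcOver-transfer a∈ b∈ r h

≤NC⁻ : ∀ {n} (α β : NC n) → α ≤NC β → ∀ {x y} → x ∈[1‥ n ] → y ∈[1‥ n ] →
       rel α x y ≡ true → rel β x y ≡ true
≤NC⁻ α β α≤β (1≤x , x≤n) (1≤y , y≤n) = α≤β _ _ 1≤x x≤n 1≤y y≤n

complement-antitone : ∀ {n} (α β : NC n) → α ≤NC β → ∀ {i j} →
                      kreweras n (rel β) i j ≡ true → kreweras n (rel α) i j ≡ true
complement-antitone {n} α β α≤β h = K⁺ λ a∈ b∈ ab →
  let a~βb = ≤NC⁻ α β α≤β a∈ b∈ (arc-rel (rel α) ab) in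
  true-ext (unseparated β h a∈ b∈ a~βb) (unseparated β (Kβ.K-sym h) a∈ b∈ a~βb)
  where
  open Complement n (rel α)
  module Kβ = Complement n (rel β)

-- The hull [m, M m] of a block of a noncrossing partition, m its minimum
-- and M m its maximum: every other block lies inside it or avoids it.
module Hulls {n : ℕ} (π : NC n) where
  open Blocks π

  M : ℕ → ℕ
  M = blockMax n (rel π)

  ∈[1‥]⁺ : ∀ {x} → x ∈[1‥ n ] → x ∈ [1‥ n ]
  ∈[1‥]⁺ (1≤x , x≤n) = ∈-range⁺ 1 n 1≤x x≤n

  M-∈block : ∀ {m} → m ∈[1‥ n ] → M m ∈ filterᵇ (rel π m) [1‥ n ]
  M-∈block {m} m∈ = maxL-∈ _ (∈-filter⁺ (T? ∘ rel π m) (∈[1‥]⁺ m∈) (true⇒T (~refl m∈)))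

  M-∈ : ∀ {m} → m ∈[1‥ n ] → M m ∈[1‥ n ]
  M-∈ {m} m∈ = ∈-range⁻ 1 n (proj₁ (∈-filter⁻ (T? ∘ rel π m) (M-∈block m∈)))

  m~M : ∀ {m} → m ∈[1‥ n ] → rel π m (M m) ≡ true
  m~M {m} m∈ = T⇒true (proj₂ (∈-filter⁻ (T? ∘ rel π m) {xs = [1‥ n ]} (M-∈block m∈)))

  ≤M : ∀ {m x} → x ∈[1‥ n ] → rel π m x ≡ true → x ≤ M m
  ≤M {m} x∈ m~x = maxL-≤ _ (∈-filter⁺ (T? ∘ rel π m) (∈[1‥]⁺ x∈) (true⇒T m~x))

  m≤M : ∀ {m} → m ∈[1‥ n ] → m ≤ M m
  m≤M m∈ = ≤M m∈ (~refl m∈)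

  enclosesHull : ∀ {m c d} → m ∈[1‥ n ] → isMin n (rel π) m ≡ true → 1 ≤ c → c < m → m ≤ d → d ≤ n →
                 rel π c d ≡ true → M m < d
  enclosesHull {m} {c} {d} m∈ m-min 1≤c c<m m≤d d≤n c~d with <-cmp d (M m)
  ... | tri> _ _ M<d = M<d
  ... | tri≈ _ refl _ = ⊥-elim (true≢false (trans (sym c~m) c≁m))
    where
    c∈ = 1≤c , ≤-trans (<⇒≤ c<m) (proj₂ m∈)
    c~m = ~trans c∈ (M-∈ m∈) m∈ c~d (~sym m∈ (M-∈ m∈) (m~M m∈))
    c≁m = isMin⁻ n (rel π) m-min c 1≤c c<m
  ... | tri< d<M _ _ = ⊥-elim (true≢false (trans (sym c~m) (isMin⁻ n (rel π) m-min c 1≤c c<m)))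
    where
    c~m : rel π c m ≡ true
    c~m with m≤n⇒m<n∨m≡n m≤d
    ... | inj₂ refl = c~d
    ... | inj₁ m<d  = NC.noncrossing π c m d (M m) 1≤c c<m m<d d<M (proj₂ (M-∈ m∈)) c~d (m~M m∈)

  closedRight : ∀ {m c d} → m ∈[1‥ n ] → m ≤ c → c ≤ M m → M m < d → d ≤ n → rel π c d ≡ true → ⊥
  closedRight {m} {c} {d} m∈ m≤c c≤M M<d d≤n c~d = <⇒≱ M<d (≤M d∈ m~d)
    where
    c∈ : c ∈[1‥ n ]
    c∈ = ≤-trans (proj₁ m∈) m≤c , ≤-trans c≤M (proj₂ (M-∈ m∈))
    d∈ : d ∈[1‥ n ]
    d∈ = ≤-trans (proj₁ c∈) (≤-trans c≤M (<⇒≤ M<d)) , d≤n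
    m~d : rel π m d ≡ true
    m~d with m≤n⇒m<n∨m≡n m≤c | m≤n⇒m<n∨m≡n c≤M
    ... | inj₂ refl | _         = c~d
    ... | inj₁ _    | inj₂ refl = ~trans m∈ (M-∈ m∈) d∈ (m~M m∈) c~d
    ... | inj₁ m<c  | inj₁ c<M  =
      ~trans m∈ c∈ d∈ (NC.noncrossing π m c (M m) d (proj₁ m∈) m<c c<M M<d d≤n (m~M m∈) c~d) c~d

module ComplementArcs {n : ℕ} (β : NC n) where
  open Blocks β
  open Hulls β
  open Complement n (rel β)

  arcToMax : ∀ {a} → suc a ≤ n → isMin n (rel β) (suc a) ≡ true → arc K a (M (suc a)) ≡ true
  arcToMax {a} a<n m-min = arc-intro K a<M (K⁺ sameSide) gap
    where
    m∈ : suc a ∈[1‥ n ]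
    m∈ = s≤s z≤n , a<n
    a<M : a < M (suc a)
    a<M = m≤M m∈
    sameSide : ∀ {c d} → c ∈[1‥ n ] → d ∈[1‥ n ] → arc (rel β) c d ≡ true → encl c d a ≡ encl c d (M (suc a))
    sameSide {c} {d} c∈ d∈ cd = true-ext over-a⇒over-M over-M⇒over-a
      where
      over-a⇒over-M : encl c d a ≡ true → encl c d (M (suc a)) ≡ true
      over-a⇒over-M h = encl-intro (≤-trans (encl-≤ c d h) (<⇒≤ a<M))
        (enclosesHull m∈ m-min (proj₁ c∈) (s≤s (encl-≤ c d h)) (encl-< c d h) (proj₂ d∈) (arc-rel (rel β) cd))
      over-M⇒over-a : encl c d (M (suc a)) ≡ true → encl c d a ≡ true
      over-M⇒over-a h with suc a ≤? c
      ... | yes m≤c = ⊥-elim (closedRight m∈ m≤c (encl-≤ c d h) (encl-< c d h) (proj₂ d∈) (arc-rel (rel β) cd))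
      ... | no  m≰c = encl-intro (≤-pred (≰⇒> m≰c)) (<-trans a<M (encl-< c d h))
    -- points strictly between a and M are cut off from a by an arc of the block of a+1
    gap : ∀ x → a < x → x < M (suc a) → K a x ≡ false
    gap x a<x x<M = ¬-not λ a~x → <⇒≱ (s≤s (encl-≤ c d (arcOver-transfer m∈ (M-∈ m∈) r (K-sym a~x)))) a≤c
      where
      r = arcOver m∈ (M-∈ m∈) a<x x<M (m~M m∈)
      open ArcOver r

  noArc : ∀ {a b} → suc a ≤ n → isMin n (rel β) (suc a) ≡ false → arc K a b ≡ false
  noArc {a} {b} a<n not-min with isMin-false⁻ n (rel β) not-min
  ... | c₀ , 1≤c₀ , c₀≤a , c₀~m =
    ¬-not λ ab → <⇒≱ (arc-< K {a} {b} ab) (≤-pred (<-≤-trans (encl-< c d (arcOver-transfer c₀∈ m∈ r (arc-rel K {a} {b} ab))) d≤b))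
    where
    c₀∈ : c₀ ∈[1‥ n ]
    c₀∈ = 1≤c₀ , ≤-trans (<⇒≤ c₀≤a) a<n
    m∈ : suc a ∈[1‥ n ]
    m∈ = s≤s z≤n , a<n
    -- an arc of the block of a+1 passes over a′, hence over b′, so b ≤ a
    r = arcOver c₀∈ m∈ (≤-pred c₀≤a) ≤-refl c₀~m
    open ArcOver r

range-cons : ∀ {m M} → m ≤ M → range m M ≡ m ∷ map suc (seg m (M ∸ m))
range-cons {m} {M} m≤M = begin
  range m M                       ≡⟨ range≡seg m M ⟩
  seg m (suc M ∸ m)               ≡⟨ cong (seg m) (+-∸-assoc 1 m≤M) ⟩
  m ∷ seg (suc m) (M ∸ m)         ≡⟨ cong (m ∷_) (seg-suc m (M ∸ m)) ⟩
  m ∷ map suc (seg m (M ∸ m))     ∎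
  where open ≡-Reasoning

between≡seg : ∀ a b → between a b ≡ seg (suc a) (b ∸ suc a)
between≡seg a b = trans (range≡seg (suc a) (b ∸ 1)) (cong (seg (suc a)) (∸-+-assoc b 1 a))

iota≡1+cuts : ∀ (ρ : Part) {m M} → m ≤ M → iotaInt ρ m M ≡ suc (countᵇ (isCut ρ m M) (seg m (M ∸ m)))
iota≡1+cuts ρ {m} {M} m≤M = begin
  iotaInt ρ m M                                       ≡⟨ cong (countᵇ starts) (range-cons m≤M) ⟩
  countᵇ starts (m ∷ map suc (seg m (M ∸ m)))         ≡⟨ count-∷ starts m _ ⟩
  (if starts m then suc rest else rest)               ≡⟨ cong (λ b → if b then suc rest else rest) starts-m ⟩
  suc rest                                            ≡⟨ cong suc (count-map starts suc (seg m (M ∸ m))) ⟩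
  suc (countᵇ (λ x → starts (suc x)) (seg m (M ∸ m))) ≡⟨ cong suc (count-cong _ _ (seg m (M ∸ m)) starts-suc) ⟩
  suc (countᵇ (isCut ρ m M) (seg m (M ∸ m)))          ∎
  where
  open ≡-Reasoning
  starts : ℕ → Bool
  starts x = (x ≡ᵇ m) ∨ isCut ρ m M (x ∸ 1)
  rest = countᵇ starts (map suc (seg m (M ∸ m)))
  starts-m : starts m ≡ true
  starts-m rewrite T⇒true (≡⇒≡ᵇ m m refl) = refl
  starts-suc : ∀ {x} → x ∈ seg m (M ∸ m) → starts (suc x) ≡ isCut ρ m M x
  starts-suc {x} x∈ rewrite ¬-not {suc x ≡ᵇ m} (λ h → <⇒≢ (s≤s (proj₁ (∈-seg⁻ m _ x∈))) (sym (≡ᵇ⇒≡ (suc x) m (true⇒T h)))) = refl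

iota-connected : ∀ (ρ : Part) {m M} → m ≤ M → ρ m M ≡ true → iotaInt ρ m M ≡ 1
iota-connected ρ {m} {M} m≤M m~M =
  trans (iota≡1+cuts ρ m≤M) (cong suc (count-none _ (seg m (M ∸ m)) noCut))
  where
  noCut : ∀ {k} → k ∈ seg m (M ∸ m) → isCut ρ m M k ≡ false
  noCut {k} k∈ = ¬-not λ cut →
    let (m≤k , k<) = ∈-seg⁻ m _ k∈ in
    true≢false (trans (sym (∧-intro m~M (encl-intro m≤k (subst (k <_) (m+[n∸m]≡n m≤M) k<))))
                      (not-injective (allRange⁻ _ m M (allRange⁻ _ m M cut m ≤-refl m≤M) M m≤M ≤-refl)))

module Cuts {n : ℕ} (α β : NC n) (α≤β : α ≤NC β) where
  open Hulls β
  open Complement n (rel α)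

  cut⇔complement : ∀ {a x} → suc a ≤ n → isMin n (rel β) (suc a) ≡ true → suc a ≤ x → x < M (suc a) →
                   K a x ≡ isCut (rel α) (suc a) (M (suc a)) x
  cut⇔complement {a} {x} a<n m-min m≤x x<M = true-ext complement⇒cut cut⇒complement
    where
    m = suc a
    m∈ : m ∈[1‥ n ]
    m∈ = s≤s z≤n , a<n
    inHull : ∀ {y} → m ≤ y → y ≤ M m → y ∈[1‥ n ]
    inHull m≤y y≤M = ≤-trans (s≤s z≤n) m≤y , ≤-trans y≤M (proj₂ (M-∈ m∈))
    -- a block of α with both ends in the hull passing over x′ has an arc
    -- over x′ inside the hull, which would also pass over a′ < m
    complement⇒cut : K a x ≡ true → isCut (rel α) m (M m) x ≡ true
    complement⇒cut a~x = allRange⁺ _ m (M m) λ y m≤y y≤M → allRange⁺ _ m (M m) λ z m≤z z≤M →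
      cong not (¬-not λ h → notSpanned m≤y y≤M m≤z z≤M (∧-conicalˡ (rel α y z) _ h) (∧-conicalʳ (rel α y z) _ h))
      where
      notSpanned : ∀ {y z} → m ≤ y → y ≤ M m → m ≤ z → z ≤ M m → rel α y z ≡ true → encl y z x ≡ true → ⊥
      notSpanned {y} {z} m≤y y≤M m≤z z≤M y~z x-under =
        <⇒≱ (s≤s (encl-≤ c d (Blocks.arcOver-transfer α y∈ z∈ r (K-sym a~x)))) (≤-trans m≤y a≤c)
        where
        y∈ = inHull m≤y y≤M
        z∈ = inHull m≤z z≤M
        r = Blocks.arcOver α y∈ z∈ (encl-≤ y z x-under) (encl-< y z x-under) y~z
        open ArcOver r
    -- an arc of α over a′ encloses the hull (as β ≥ α), so it passes over x′;
    -- an arc over x′ but not a′ lies in the hull and would contradict the cut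
    cut⇒complement : isCut (rel α) m (M m) x ≡ true → K a x ≡ true
    cut⇒complement cut = K⁺ λ {c} {d} c∈ d∈ cd →
      let c~βd = ≤NC⁻ α β α≤β c∈ d∈ (arc-rel (rel α) cd) in
      true-ext (over-a⇒over-x c∈ d∈ c~βd) (over-x⇒over-a c∈ d∈ c~βd (arc-rel (rel α) cd))
      where
      over-a⇒over-x : ∀ {c d} → c ∈[1‥ n ] → d ∈[1‥ n ] → rel β c d ≡ true → encl c d a ≡ true → encl c d x ≡ true
      over-a⇒over-x {c} {d} c∈ d∈ c~βd a-under =
        encl-intro (≤-trans (encl-≤ c d a-under) (≤-trans (n≤1+n a) m≤x))
          (<-trans x<M (enclosesHull m∈ m-min (proj₁ c∈) (s≤s (encl-≤ c d a-under)) (encl-< c d a-under) (proj₂ d∈) c~βd))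
      over-x⇒over-a : ∀ {c d} → c ∈[1‥ n ] → d ∈[1‥ n ] → rel β c d ≡ true → rel α c d ≡ true →
                      encl c d x ≡ true → encl c d a ≡ true
      over-x⇒over-a {c} {d} _ d∈ c~βd c~d x-under with m ≤? c | d ≤? M m
      ... | no m≰c | _       = encl-intro (≤-pred (≰⇒> m≰c)) (<-≤-trans (≤-trans m≤x (n≤1+n x)) (encl-< c d x-under))
      ... | yes m≤c | no d≰M = ⊥-elim (closedRight m∈ m≤c c≤M (≰⇒> d≰M) (proj₂ d∈) c~βd)
        where c≤M = ≤-trans (encl-≤ c d x-under) (<⇒≤ x<M)
      ... | yes m≤c | yes d≤M = ⊥-elim (true≢false (trans (sym (∧-intro c~d x-under)) (not-injective notSpan)))
        where
        c≤M = ≤-trans (encl-≤ c d x-under) (<⇒≤ x<M)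
        notSpan = allRange⁻ _ m (M m) (allRange⁻ _ m (M m) cut c m≤c c≤M) d (≤-trans m≤x (<⇒≤ (encl-< c d x-under))) d≤M

  complementCount : ∀ {a} → suc a ≤ n → isMin n (rel β) (suc a) ≡ true →
                    countᵇ (K a) (between a (M (suc a))) ≡ iotaInt (rel α) (suc a) (M (suc a)) ∸ 1
  complementCount {a} a<n m-min = begin
    countᵇ (K a) (between a (M m))                        ≡⟨ cong (countᵇ (K a)) (between≡seg a (M m)) ⟩
    countᵇ (K a) (seg m (M m ∸ m))                        ≡⟨ count-cong _ _ (seg m (M m ∸ m)) complement≡cut ⟩
    countᵇ (isCut (rel α) m (M m)) (seg m (M m ∸ m))      ≡⟨ cong (_∸ 1) (sym (iota≡1+cuts (rel α) hull)) ⟩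
    iotaInt (rel α) m (M m) ∸ 1                           ∎
    where
    open ≡-Reasoning
    m = suc a
    hull : m ≤ M m
    hull = m≤M (s≤s z≤n , a<n)
    complement≡cut : ∀ {x} → x ∈ seg m (M m ∸ m) → K a x ≡ isCut (rel α) m (M m) x
    complement≡cut {x} x∈ with ∈-seg⁻ m _ x∈
    ... | m≤x , x< = cut⇔complement a<n m-min m≤x (subst (x <_) (m+[n∸m]≡n hull) x<)

-- Finite products in a commutative semiring (prod and prodIf do not
-- involve the weights δ, which are therefore taken constant here).
module Products {c ℓ : Level} (R : CommutativeSemiring c ℓ) where
  open CommutativeSemiring R
    using (Carrier; _≈_; _*_; 1#; setoid; *-assoc; *-comm; *-cong; *-congˡ; *-congʳ;
           *-identityˡ; *-identityʳ)
    renaming (refl to ≈-refl; sym to ≈-sym; trans to ≈-trans)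
  open import Algebra.Properties.CommutativeSemigroup (CommutativeSemiring.*-commutativeSemigroup R) using (interchange)
  open import Relation.Binary.Reasoning.Setoid setoid
  open Weights R (λ _ → 1#) using (prod; prodIf)

  cond : Bool → Carrier → Carrier
  cond b x = if b then x else 1#

  cond-false : ∀ {b x} → b ≡ false → cond b x ≈ 1#
  cond-false refl = ≈-refl

  cond-true : ∀ {b x} → b ≡ true → cond b x ≈ x
  cond-true refl = ≈-refl

  prod-cong : ∀ xs {f g : ℕ → Carrier} → (∀ {x} → x ∈ xs → f x ≈ g x) → prod xs f ≈ prod xs g
  prod-cong []       _ = ≈-refl
  prod-cong (x ∷ xs) h = *-cong (h (here refl)) (prod-cong xs (λ x∈ → h (there x∈)))

  prod-one : ∀ xs {f : ℕ → Carrier} → (∀ {x} → x ∈ xs → f x ≈ 1#) → prod xs f ≈ 1#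
  prod-one []       _ = ≈-refl
  prod-one (x ∷ xs) h = ≈-trans (*-cong (h (here refl)) (prod-one xs (λ x∈ → h (there x∈)))) (*-identityˡ 1#)

  prod-* : ∀ xs (f g : ℕ → Carrier) → prod xs (λ x → f x * g x) ≈ prod xs f * prod xs g
  prod-* []       f g = ≈-sym (*-identityˡ 1#)
  prod-* (x ∷ xs) f g = ≈-trans (*-congˡ (prod-* xs f g)) (interchange (f x) (g x) (prod xs f) (prod xs g))

  prod-swap : ∀ xs ys (f : ℕ → ℕ → Carrier) →
              prod xs (λ x → prod ys (f x)) ≈ prod ys (λ y → prod xs (λ x → f x y))
  prod-swap []       ys f = ≈-sym (prod-one ys (λ _ → ≈-refl))
  prod-swap (x ∷ xs) ys f =
    ≈-trans (*-congˡ (prod-swap xs ys f)) (≈-sym (prod-* ys (f x) (λ y → prod xs (λ x → f x y))))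

  prodIf≈prod-cond : ∀ xs (p : ℕ → Bool) (f : ℕ → Carrier) → prodIf xs p f ≈ prod xs (λ x → cond (p x) (f x))
  prodIf≈prod-cond []       p f = ≈-refl
  prodIf≈prod-cond (x ∷ xs) p f with p x
  ... | true  = *-congˡ (prodIf≈prod-cond xs p f)
  ... | false = ≈-trans (prodIf≈prod-cond xs p f) (≈-sym (*-identityˡ _))

  cond-prod : ∀ b xs (f : ℕ → Carrier) → cond b (prod xs f) ≈ prod xs (λ x → cond b (f x))
  cond-prod true  xs f = ≈-refl
  cond-prod false xs f = ≈-sym (prod-one xs (λ _ → ≈-refl))

  prod-single : ∀ a k {j} (f : ℕ → Carrier) → j ∈ seg a k →
                (∀ {x} → x ∈ seg a k → x ≢ j → f x ≈ 1#) → prod (seg a k) f ≈ f j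
  prod-single a (suc k) f (here refl) h =
    ≈-trans (*-congˡ (prod-one (seg (suc a) k) (λ x∈ → h (there x∈) (λ x≡a → <-irrefl (sym x≡a) (proj₁ (∈-seg⁻ _ k x∈))))))
            (*-identityʳ (f a))
  prod-single a (suc k) f (there j∈) h =
    ≈-trans (*-cong (h (here refl) (λ a≡j → <-irrefl a≡j (proj₁ (∈-seg⁻ _ k j∈)))) (prod-single (suc a) k f j∈ (λ x∈ → h (there x∈))))
            (*-identityˡ _)

  prod-[1‥]-single : ∀ n {j} (f : ℕ → Carrier) → j ∈[1‥ n ] →
                     (∀ {x} → x ∈[1‥ n ] → x ≢ j → f x ≈ 1#) → prod [1‥ n ] f ≈ f j
  prod-[1‥]-single n f (1≤j , j≤n) h rewrite [1‥]≡seg n =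
    prod-single 1 n f (∈-seg⁺ 1 n 1≤j (s≤s j≤n)) (λ x∈ → h (proj₁ (∈-seg⁻ 1 n x∈) , ≤-pred (proj₂ (∈-seg⁻ 1 n x∈))))

  prod-map : ∀ (h : ℕ → ℕ) xs (f : ℕ → Carrier) → prod (map h xs) f ≡ prod xs (λ x → f (h x))
  prod-map h []       f = refl
  prod-map h (x ∷ xs) f = cong (f (h x) *_) (prod-map h xs f)

  prod-snoc : ∀ a k (f : ℕ → Carrier) → prod (seg a (suc k)) f ≈ prod (seg a k) f * f (a + k)
  prod-snoc a zero    f rewrite +-identityʳ a = *-comm (f a) 1#
  prod-snoc a (suc k) f rewrite +-suc a k =
    ≈-trans (*-congˡ (prod-snoc (suc a) k f)) (≈-sym (*-assoc (f a) _ _))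

  prod-reindex : ∀ a k (f g : ℕ → Carrier) → f (a + k) ≈ 1# → g a ≈ 1# →
                 (∀ {x} → x ∈ seg a k → f x ≈ g (suc x)) → prod (seg a (suc k)) f ≈ prod (seg a (suc k)) g
  prod-reindex a k f g f-last g-first shift = begin
    prod (seg a (suc k)) f               ≈⟨ prod-snoc a k f ⟩
    prod (seg a k) f * f (a + k)         ≈⟨ *-congˡ f-last ⟩
    prod (seg a k) f * 1#                ≈⟨ *-identityʳ _ ⟩
    prod (seg a k) f                     ≈⟨ prod-cong (seg a k) shift ⟩
    prod (seg a k) (λ x → g (suc x))     ≡⟨ sym (prod-map suc (seg a k) g) ⟩
    prod (map suc (seg a k)) g           ≡⟨ cong (λ xs → prod xs g) (sym (seg-suc a k)) ⟩
    prod (seg (suc a) k) g               ≈⟨ ≈-sym (*-identityˡ _) ⟩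
    1# * prod (seg (suc a) k) g          ≈⟨ *-congʳ (≈-sym g-first) ⟩
    prod (seg a (suc k)) g               ∎

  prod-[1‥]-reindex : ∀ n (f g : ℕ → Carrier) → (1 ≤ n → f n ≈ 1#) → (1 ≤ n → g 1 ≈ 1#) →
                      (∀ {x} → 1 ≤ x → x < n → f x ≈ g (suc x)) → prod [1‥ n ] f ≈ prod [1‥ n ] g
  prod-[1‥]-reindex zero    f g _      _       _     = ≈-refl
  prod-[1‥]-reindex (suc k) f g f-last g-first shift =
    subst (λ xs → prod xs f ≈ prod xs g) (sym ([1‥]≡seg (suc k)))
      (prod-reindex 1 k f g (f-last (s≤s z≤n)) (g-first (s≤s z≤n))
        (λ x∈ → shift (proj₁ (∈-seg⁻ 1 k x∈)) (proj₂ (∈-seg⁻ 1 k x∈))))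

module Assembly {c ℓ : Level} (R : CommutativeSemiring c ℓ) (δ : ℕ → CommutativeSemiring.Carrier R)
                (δ₀ : CommutativeSemiring._≈_ R (δ 0) (CommutativeSemiring.1# R))
                {n : ℕ} (α β : NC n) (α≤β : α ≤NC β) where
  open CommutativeSemiring R using (Carrier; _≈_; 1#)
    renaming (refl to ≈-refl; sym to ≈-sym; trans to ≈-trans; reflexive to ≈-reflexive)
  open Weights R δ
  open Products R
  open Hulls β using (M; M-∈; m≤M)
  open Complement n (rel α) using (blockMin; blockMin-unique) renaming (K to Kα; K-trans to Kα-trans; K-sym to Kα-sym; K-block to Kα-block)
  open Complement n (rel β) using () renaming (K to Kβ)
  open ComplementArcs β using (arcToMax; noArc)
  open Cuts α β α≤β using (complementCount)

  -- the contribution to wt(β^c|B) of the arcs starting at a, B the block of α^c with minimum m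
  arcsIn : ℕ → ℕ → Carrier
  arcsIn m a = prodIf [1‥ n ] (arcIn (Kα m) Kβ a) (λ b → δ (countᵇ (Kα m) (between a b)))

  -- the same contribution, taken in the block of a itself
  arcsFrom : ℕ → Carrier
  arcsFrom a = prod [1‥ n ] (λ b → cond (arc Kβ a b) (δ (countᵇ (Kα a) (between a b))))

  hullFactor : ℕ → Carrier
  hullFactor m = cond (isMin n (rel β) m ∧ not (rel β m 1) ∧ not (rel α m (M m))) (δ (iotaInt (rel α) m (M m) ∸ 1))

  hullAfter : ℕ → Carrier
  hullAfter a = cond ((a <ᵇ n) ∧ isMin n (rel β) (suc a)) (δ (iotaInt (rel α) (suc a) (M (suc a)) ∸ 1))

  -- β^c ≤ α^c, so ζ(β^c, α^c) is a genuine product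
  complement-leq : leqᵇ n Kβ Kα ≡ true
  complement-leq = allRange⁺ _ 1 n λ i _ _ → allRange⁺ _ 1 n λ j _ _ → ⇒ᵇ-intro (complement-antitone α β α≤β)

  zeta-unfold : zeta n Kβ Kα ≡ prodIf [1‥ n ] (isMin n Kα) (λ m → prod [1‥ n ] (arcsIn m))
  zeta-unfold rewrite complement-leq = refl

  -- Only the block of α^c containing a sees the arcs of β^c starting at a,
  -- since each arc of β^c lies in a block of α^c.
  ownBlock : ∀ {a} → a ∈[1‥ n ] → prod [1‥ n ] (λ m → cond (isMin n Kα m) (arcsIn m a)) ≈ arcsFrom a
  ownBlock {a} a∈ with blockMin a∈
  ... | j , j∈ , j-min , j~a = ≈-trans (prod-[1‥]-single n _ j∈ other)
      (≈-trans (cond-true j-min) (≈-trans (prodIf≈prod-cond [1‥ n ] (arcIn (Kα j) Kβ a) _) (prod-cong [1‥ n ] same)))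
    where
    other : ∀ {m} → m ∈[1‥ n ] → m ≢ j → cond (isMin n Kα m) (arcsIn m a) ≈ 1#
    other {m} m∈ m≢j with isMin n Kα m in m-min
    ... | false = ≈-refl
    ... | true  = ≈-trans (prodIf≈prod-cond [1‥ n ] (arcIn (Kα m) Kβ a) _) (prod-one [1‥ n ] (λ _ → cond-false arcIn≡false))
      where
      m≁a : Kα m a ≡ false
      m≁a = ¬-not λ m~a → m≢j (blockMin-unique m∈ j∈ m-min j-min (Kα-trans m~a (Kα-sym j~a)))
      arcIn≡false : ∀ {b} → arcIn (Kα m) Kβ a b ≡ false
      arcIn≡false rewrite m≁a = refl
    same : ∀ {b} → b ∈ [1‥ n ] → cond (arcIn (Kα j) Kβ a b) (δ (countᵇ (Kα j) (between a b)))
                                  ≈ cond (arc Kβ a b) (δ (countᵇ (Kα a) (between a b)))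
    same {b} _ = ≈-reflexive (cong₂ (λ arc? k → cond arc? (δ k))
      (arcIn-block (Kα j) Kβ j~a (λ a~x → Kα-trans j~a (complement-antitone α β α≤β a~x)))
      (count-cong (Kα j) (Kα a) (between a b) (λ {x} _ → Kα-block j~a x)))

  -- An arc of β^c starts at a only if a+1 is the minimum of a block of β;
  -- it then ends at the maximum of that block and weighs δ_{ι−1}.
  arcsFrom≈ : ∀ {a} → a ∈[1‥ n ] → arcsFrom a ≈ hullAfter a
  arcsFrom≈ {a} a∈ with a <? n
  ... | no a≮n = ≈-trans (prod-one [1‥ n ] (λ {b} b∈ → cond-false {arc Kβ a b} (¬-not λ ab → a≮n (<-≤-trans (arc-< Kβ ab) (proj₂ (∈-range⁻ 1 n b∈))))))
                         (≈-sym (cond-false (cong (_∧ isMin n (rel β) (suc a)) (¬-not (λ a<ᵇn → a≮n (<ᵇ-true⁻ a<ᵇn))))))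
  ... | yes a<n with isMin n (rel β) (suc a) in m-min
  ...   | false = ≈-trans (prod-one [1‥ n ] (λ {b} _ → cond-false {arc Kβ a b} (noArc {b = b} a<n m-min))) (≈-sym (cond-false (∧-zeroʳ (a <ᵇ n))))
  ...   | true  = ≈-trans (prod-[1‥]-single n _ (M-∈ m∈) onlyArc)
                  (≈-trans (cond-true (arcToMax a<n m-min))
                  (≈-trans (≈-reflexive (cong δ (complementCount a<n m-min)))
                           (≈-sym (cond-true (∧-intro (<ᵇ-true a<n) refl)))))
    where
    m∈ : suc a ∈[1‥ n ]
    m∈ = s≤s z≤n , a<n
    onlyArc : ∀ {b} → b ∈[1‥ n ] → b ≢ M (suc a) → cond (arc Kβ a b) (δ (countᵇ (Kα a) (between a b))) ≈ 1#
    onlyArc b∈ b≢M = cond-false (¬-not λ ab → b≢M (arc-unique Kβ ab (arcToMax a<n m-min)))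

  min≁1 : ∀ {m} → m ∈[1‥ n ] → 1 < m → isMin n (rel β) m ≡ true → rel β m 1 ≡ false
  min≁1 m∈ 1<m m-min = ¬-not λ m~1 →
    true≢false (trans (sym (Blocks.~sym β m∈ (≤-refl , ≤-trans (<⇒≤ 1<m) (proj₂ m∈)) m~1)) (isMin⁻ n (rel β) m-min 1 ≤-refl 1<m))

  -- For a ≥ 1 the block of β with minimum a+1 does not contain 1; if it joins
  -- the ends of its hull in α then ι = 1 and its factor is δ₀ = 1.
  hullFactor-suc : ∀ {a} → 1 ≤ a → suc a ≤ n →
                   cond (isMin n (rel β) (suc a)) (δ (iotaInt (rel α) (suc a) (M (suc a)) ∸ 1)) ≈ hullFactor (suc a)
  hullFactor-suc {a} 1≤a a<n with isMin n (rel β) (suc a) in m-min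
  ... | false = ≈-refl
  ... | true rewrite min≁1 (s≤s z≤n , a<n) (s≤s 1≤a) m-min with rel α (suc a) (M (suc a)) in m~M
  ...   | false = ≈-refl
  ...   | true  = ≈-trans (≈-reflexive (cong (λ ι → δ (ι ∸ 1)) (iota-connected (rel α) (m≤M (s≤s z≤n , a<n)) m~M))) δ₀

  -- The factor of a < n is that of the block of β with minimum a+1; the
  -- block containing 1 has factor 1.
  shiftToHulls : prod [1‥ n ] hullAfter ≈ prod [1‥ n ] hullFactor
  shiftToHulls = prod-[1‥]-reindex n hullAfter hullFactor last first step
    where
    last : 1 ≤ n → hullAfter n ≈ 1#
    last _ = cond-false {(n <ᵇ n) ∧ isMin n (rel β) (suc n)}
                        (cong (_∧ isMin n (rel β) (suc n)) (¬-not {n <ᵇ n} λ n<ᵇn → <-irrefl refl (<ᵇ-true⁻ {n} {n} n<ᵇn)))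
    first : 1 ≤ n → hullFactor 1 ≈ 1#
    first 1≤n = cond-false (trans (cong (λ t → isMin n (rel β) 1 ∧ not t ∧ not (rel α 1 (M 1))) (Blocks.~refl β (≤-refl , 1≤n)))
                                  (∧-zeroʳ (isMin n (rel β) 1)))
    step : ∀ {x} → 1 ≤ x → x < n → hullAfter x ≈ hullFactor (suc x)
    step {x} 1≤x x<n rewrite <ᵇ-true x<n = hullFactor-suc 1≤x x<n

  -- Summing over blocks of α^c and then over arcs of β^c, each arc is
  -- counted in its own block, so ζ is a product over starting points.
  zeta≈arcsFrom : zeta n Kβ Kα ≈ prod [1‥ n ] arcsFrom
  zeta≈arcsFrom = begin
    zeta n Kβ Kα
      ≡⟨ zeta-unfold ⟩
    prodIf [1‥ n ] (isMin n Kα) (λ m → prod [1‥ n ] (arcsIn m))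
      ≈⟨ prodIf≈prod-cond [1‥ n ] (isMin n Kα) _ ⟩
    prod [1‥ n ] (λ m → cond (isMin n Kα m) (prod [1‥ n ] (arcsIn m)))
      ≈⟨ prod-cong [1‥ n ] (λ {m} _ → cond-prod (isMin n Kα m) [1‥ n ] (arcsIn m)) ⟩
    prod [1‥ n ] (λ m → prod [1‥ n ] (λ a → cond (isMin n Kα m) (arcsIn m a)))
      ≈⟨ prod-swap [1‥ n ] [1‥ n ] _ ⟩
    prod [1‥ n ] (λ a → prod [1‥ n ] (λ m → cond (isMin n Kα m) (arcsIn m a)))
      ≈⟨ prod-cong [1‥ n ] (λ a∈ → ownBlock (∈-range⁻ 1 n a∈)) ⟩
    prod [1‥ n ] arcsFrom ∎
    where open import Relation.Binary.Reasoning.Setoid (CommutativeSemiring.setoid R)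

lemma5p6 : ∀ {c ℓ : Level} (R : CommutativeSemiring c ℓ)
             (δ : ℕ → CommutativeSemiring.Carrier R) →
             CommutativeSemiring._≈_ R (δ 0) (CommutativeSemiring.1# R) →
             (n : ℕ) (α β : NC n) → α ≤NC β →
             CommutativeSemiring._≈_ R
               (Weights.zeta R δ n (kreweras n (rel β)) (kreweras n (rel α)))
               (Weights.rhs R δ n (rel α) (rel β))
lemma5p6 R δ δ₀ n α β α≤β = begin
  zeta n (kreweras n (rel β)) (kreweras n (rel α)) ≈⟨ zeta≈arcsFrom ⟩
  prod [1‥ n ] arcsFrom                            ≈⟨ prod-cong [1‥ n ] (λ a∈ → arcsFrom≈ (∈-range⁻ 1 n a∈)) ⟩
  prod [1‥ n ] hullAfter                           ≈⟨ shiftToHulls ⟩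
  prod [1‥ n ] hullFactor                          ≈⟨ ≈-sym (prodIf≈prod-cond [1‥ n ] _ _) ⟩
  rhs n (rel α) (rel β)                            ∎
  where
  open CommutativeSemiring R using (setoid) renaming (sym to ≈-sym)
  open import Relation.Binary.Reasoning.Setoid setoid
  open Weights R δ
  open Products R
  open Assembly R δ δ₀ α β α≤β
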